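{- Let $n\ge 5$, let $i\in\{1,2,3\}$, and let $B\in Q(\mathcal{A}_i)$ be the real $n\times n$ matrix $$B=\begin{bmatrix} a_1&1&1&\cdots&1\\ a_2&0&&&\\ a_3&&-b_1&&\\ \vdots&&&\ddots&\\ a_n&&&&-b_{n-2}\end{bmatrix}$$ (all unspecified entries zero), where $b_j>0$ for $j=1,\dots,n-3$ and $b_1>b_2>\cdots>b_{n-2}$. Then the sign of $\det(b_jI+B)$ is $(-1)^{j+1}$ for $j=1,\dots,n-2$ if $i=1$; $(-1)^{j}$ for $j=1,\dots,n-2$ if $i=2$; and $(-1)^{j}$ for $j=1,\dots,n-3$ if $i=3$.
   Context: For an $n\times n$ sign pattern $\mathcal{A}$ (matrix with entries in $\{+,-,0\}$), $Q(\mathcal{A})$ is the set of real matrices whose entrywise signs equal $\mathcal{A}$. The $n\times n$ sign patterns are: in all three, every off-diagonal entry not in the first row or first column is $0$, and the $(2,2)$ entry is $0$. $\mathcal{A}_1$: $(1,1)$ entry $+$, entries $(1,j)$, $j\ge2$, are $+$, entries $(j,1)$, $j\ge 2$, are $-$, diagonal entries $(j,j)$, $3\le j\le n$, are $-$. $\mathcal{A}_2$: $(1,1)$ entry $-$, entries $(1,j)$, $j\ge 2$, are $+$, $(2,1)$ entry $-$, entries $(j,1)$, $3\le j\le n$, are $+$, diagonal entries $(j,j)$, $3\le j\le n$, are $-$. $\mathcal{A}_3$: $(1,1)$ entry $-$, entries $(1,j)$, $j\ge2$, are $+$, entries $(j,1)$, $2\le j\le n-1$, are $+$, $(n,1)$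 entry $-$, diagonal entries $(j,j)$, $3\le j\le n-1$, are $-$, and $(n,n)$ entry $+$. -}

module Defs where

open import Level using (Level; _⊔_) renaming (suc to lsuc)
open import Algebra.Bundles using (CommutativeRing)
open import Relation.Binary.Core using (Rel)
open import Relation.Binary.Structures using (IsStrictTotalOrder)
open import Relation.Nullary using (¬_)
open import Data.Product using (∃)
open import Data.Nat using (ℕ; zero; suc; _∸_; _≡ᵇ_; _≤ᵇ_)
open import Data.Bool using (Bool; true; false; if_then_else_; _∧_)
open import Data.Fin using (Fin; toℕ; punchIn)
open import Data.Sign using (Sign) renaming (+ to s+; - to s-)

-- Ordered fields (the reals are an instance).  The stdlib has no reals,
-- so the statement is made for an arbitrary ordered field.

record OrderedField (c ℓ₁ ℓ₂ : Level) : Set (lsuc (c ⊔ ℓ₁ ⊔ ℓ₂)) where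
  field
    commutativeRing : CommutativeRing c ℓ₁
  open CommutativeRing commutativeRing public
  field
    _<_                : Rel Carrier ℓ₂
    isStrictTotalOrder : IsStrictTotalOrder _≈_ _<_
    0<1                : 0# < 1#
    +-monoˡ-<          : ∀ {x y} z → x < y → (x + z) < (y + z)
    *-pos              : ∀ {x y} → 0# < x → 0# < y → 0# < (x * y)
    *-inverse          : ∀ x → ¬ (x ≈ 0#) → ∃ λ y → (x * y) ≈ 1#

data SignEntry : Set where
  pos neg zer : SignEntry

-- n × n sign pattern, indexed 1-based by (row, column) ∈ ℕ × ℕ
SignPattern : Set
SignPattern = ℕ → ℕ → SignEntry

𝒜₁ : ℕ → SignPattern
𝒜₁ n r c =
  if r ≡ᵇ 1 then pos
  else if c ≡ᵇ 1 then neg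
  else if (r ≡ᵇ c) ∧ (3 ≤ᵇ r) then neg
  else zer

𝒜₂ : ℕ → SignPattern
𝒜₂ n r c =
  if r ≡ᵇ 1 then (if c ≡ᵇ 1 then neg else pos)
  else if c ≡ᵇ 1 then (if r ≡ᵇ 2 then neg else pos)
  else if (r ≡ᵇ c) ∧ (3 ≤ᵇ r) then neg
  else zer

𝒜₃ : ℕ → SignPattern
𝒜₃ n r c =
  if r ≡ᵇ 1 then (if c ≡ᵇ 1 then neg else pos)
  else if c ≡ᵇ 1 then (if r ≡ᵇ n then neg else pos)
  else if r ≡ᵇ c then (if r ≡ᵇ n then pos else if 3 ≤ᵇ r then neg else zer)
  else zer

𝒜 : Fin 3 → ℕ → SignPattern
𝒜 Fin.zero          = 𝒜₁
𝒜 (Fin.suc Fin.zero) = 𝒜₂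
𝒜 (Fin.suc (Fin.suc Fin.zero)) = 𝒜₃

signPow : ℕ → Sign
signPow zero    = s+
signPow (suc k) = Data.Sign.opposite (signPow k)
  where import Data.Sign

module _ {c ℓ₁ ℓ₂} (F : OrderedField c ℓ₁ ℓ₂) where
  open OrderedField F

  Matrix : ℕ → Set c
  Matrix n = Fin n → Fin n → Carrier

  HasSignEntry : Carrier → SignEntry → Set (ℓ₁ ⊔ ℓ₂)
  HasSignEntry x pos = Level.Lift (ℓ₁ ⊔ ℓ₂) (0# < x)
  HasSignEntry x neg = Level.Lift (ℓ₁ ⊔ ℓ₂) (x < 0#)
  HasSignEntry x zer = Level.Lift (ℓ₁ ⊔ ℓ₂) (x ≈ 0#)

  HasSign : Carrier → Sign → Set ℓ₂
  HasSign x s+ = 0# < x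
  HasSign x s- = x < 0#

  InQ : ∀ {n} → SignPattern → Matrix n → Set (ℓ₁ ⊔ ℓ₂)
  InQ {n} P B = ∀ (r s : Fin n) → HasSignEntry (B r s) (P (suc (toℕ r)) (suc (toℕ s)))

  sumFin : ∀ {n} → (Fin n → Carrier) → Carrier
  sumFin {zero}  f = 0#
  sumFin {suc n} f = f Fin.zero + sumFin (λ i → f (Fin.suc i))

  negPow : ℕ → Carrier → Carrier
  negPow zero    x = x
  negPow (suc k) x = - negPow k x

  det : ∀ {n} → Matrix n → Carrier
  det {zero}  M = 1#
  det {suc n} M =
    sumFin (λ i → negPow (toℕ i) (M i Fin.zero * det (λ r s → M (punchIn i r) (Fin.suc s))))

  identity : ∀ {n} → Matrix n
  identity r s = if toℕ r ≡ᵇ toℕ s then 1# else 0#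

  shift : ∀ {n} → Carrier → Matrix n → Matrix n
  shift x M r s = (x * identity r s) + M r s

  -- The matrix B of the lemma, with a = (a₁,…,aₙ), b = (b₁,…,b_{n-2})
  -- given as 1-based functions ℕ → Carrier (values at other indices unused).
  arrowB : (n : ℕ) → (ℕ → Carrier) → (ℕ → Carrier) → Matrix n
  arrowB n a b r s =
    let R = suc (toℕ r) ; S = suc (toℕ s) in
    if R ≡ᵇ 1 then (if S ≡ᵇ 1 then a 1 else 1#)
    else if S ≡ᵇ 1 then a R
    else if R ≡ᵇ S then (if R ≡ᵇ 2 then 0# else - b (R ∸ 2))
    else 0#

upper : Fin 3 → ℕ → ℕ
upper Fin.zero n = n ∸ 2
upper (Fin.suc Fin.zero) n = n ∸ 2
upper (Fin.suc (Fin.suc Fin.zero)) n = n ∸ 3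

expectedSign : Fin 3 → ℕ → Sign
expectedSign Fin.zero j = signPow (suc j)
expectedSign (Fin.suc Fin.zero) j = signPow j
expectedSign (Fin.suc (Fin.suc Fin.zero)) j = signPow j

module Submission where

-- Let B be the arrow matrix of the statement, j a row index of the
-- b-diagonal and M = b_j I + B.  Row j+1 of M (0-based) has diagonal entry
-- b_j - b_j = 0, so it vanishes outside column 0, and the first-column
-- expansion of det M collapses to a single term:
--   det M = (-1)^(j+1) a_{j+2} det M',
-- where M' deletes that row and column 0 of M.  Every row of M' except the
-- first (a row of ones) has a single nonzero entry, and these entries sit in
-- a "staircase": a general lemma (det-monomialRows) evaluates such a
-- determinant to (-1)^j times the product of the staircase entries.  Those
-- entries are b_j > 0 followed by b_j - b_t, negative for t < j and positive
-- for t > j because the b_t decrease; so det M' < 0.  The sign of a_{j+2}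
-- read off the pattern A_i then gives the theorem.

open import Defs
open import Level using (lower)
open import Function using (_∘_)
open import Data.Nat using (ℕ; zero; suc; _≤_; _<_; _∸_; _≡ᵇ_; z≤n; s≤s)
open import Data.Nat.Properties
  using (≤-trans; ≤-pred; <⇒≤; <⇒≢; m≤n⇒m<n∨m≡n; m≤n⇒m≤1+n)
open import Data.Fin using (Fin; zero; suc; toℕ; punchIn; punchOut; fromℕ<)
open import Data.Fin.Properties
  using (suc-injective; toℕ-injective; toℕ<n; toℕ-fromℕ<; punchIn-punchOut)
  renaming (_≟_ to _≟ᶠ_)
open import Data.Bool using (true; false)
open import Data.Sign using (opposite) renaming (+ to s+; - to s-)
open import Data.Sum using (_⊎_; inj₁; inj₂)
open import Data.Empty using (⊥-elim)
open import Relation.Nullary using (yes; no)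
open import Relation.Binary.PropositionalEquality
  using (_≡_; _≢_; refl; sym; cong; subst)
open import Relation.Binary.Structures using (IsStrictTotalOrder)
import Algebra.Properties.Ring as RingProperties

≡ᵇ-refl : ∀ m → (m ≡ᵇ m) ≡ true
≡ᵇ-refl zero    = refl
≡ᵇ-refl (suc m) = ≡ᵇ-refl m

≡ᵇ-false : ∀ m k → m ≢ k → (m ≡ᵇ k) ≡ false
≡ᵇ-false zero    zero    m≢k = ⊥-elim (m≢k refl)
≡ᵇ-false zero    (suc k) _   = refl
≡ᵇ-false (suc m) zero    _   = refl
≡ᵇ-false (suc m) (suc k) m≢k = ≡ᵇ-false m k (m≢k ∘ cong suc)

toℕ-punchIn-below : ∀ {m} (p : Fin (suc m)) (r : Fin m) →
                    toℕ r < toℕ p → toℕ (punchIn p r) ≡ toℕ r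
toℕ-punchIn-below (suc p) zero    _         = refl
toℕ-punchIn-below (suc p) (suc r) (s≤s r<p) = cong suc (toℕ-punchIn-below p r r<p)

toℕ-punchIn-above : ∀ {m} (p : Fin (suc m)) (r : Fin m) →
                    toℕ p ≤ toℕ r → toℕ (punchIn p r) ≡ suc (toℕ r)
toℕ-punchIn-above zero    r       _         = refl
toℕ-punchIn-above (suc p) (suc r) (s≤s p≤r) = cong suc (toℕ-punchIn-above p r p≤r)

viaFin : ∀ {ℓ k} (P : ℕ → Set ℓ) → (∀ (p : Fin k) → P (toℕ p)) → ∀ j → j < k → P j
viaFin P h j j<k = subst P (toℕ-fromℕ< j<k) (h (fromℕ< j<k))

module Development {c ℓ₁ ℓ₂} (F : OrderedField c ℓ₁ ℓ₂) where
  open OrderedField F hiding (zero)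
    renaming (_<_ to infix 4 _<ᶠ_; refl to ≈-refl; sym to ≈-sym; trans to ≈-trans)
  open RingProperties ring using (-‿distribˡ-*; -‿distribʳ-*; -‿involutive; -0#≈0#)
  open IsStrictTotalOrder isStrictTotalOrder using (<-respˡ-≈; <-respʳ-≈)
    renaming (trans to <-trans)
  open import Algebra.Properties.CommutativeSemigroup *-commutativeSemigroup using (x∙yz≈y∙xz)
  open import Relation.Binary.Reasoning.Setoid setoid

  private
    variable
      m : ℕ
      x y u : Carrier

  neg⇒-pos : x <ᶠ 0# → 0# <ᶠ - x
  neg⇒-pos {x} x<0 = <-respˡ-≈ (-‿inverseʳ x) (<-respʳ-≈ (+-identityˡ (- x)) (+-monoˡ-< (- x) x<0))

  -pos⇒neg : 0# <ᶠ - x → x <ᶠ 0#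
  -pos⇒neg {x} h = <-respʳ-≈ (-‿inverseˡ x) (<-respˡ-≈ (+-identityˡ x) (+-monoˡ-< x h))

  pos⇒-neg : 0# <ᶠ x → - x <ᶠ 0#
  pos⇒-neg {x} h = -pos⇒neg (<-respʳ-≈ (≈-sym (-‿involutive x)) h)

  sub-pos : y <ᶠ x → 0# <ᶠ x - y
  sub-pos {y} y<x = <-respˡ-≈ (-‿inverseʳ y) (+-monoˡ-< (- y) y<x)

  sub-neg : x <ᶠ y → x - y <ᶠ 0#
  sub-neg {y = y} x<y = <-respʳ-≈ (-‿inverseʳ y) (+-monoˡ-< (- y) x<y)

  neg-*-neg : x <ᶠ 0# → y <ᶠ 0# → 0# <ᶠ x * y
  neg-*-neg {x} {y} x<0 y<0 = <-respʳ-≈ minus-squared (*-pos (neg⇒-pos x<0) (neg⇒-pos y<0))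
    where
    minus-squared : - x * - y ≈ x * y
    minus-squared = begin
      - x * - y      ≈⟨ -‿distribˡ-* x (- y) ⟨
      - (x * - y)    ≈⟨ -‿cong (-‿distribʳ-* x y) ⟨
      - - (x * y)    ≈⟨ -‿involutive (x * y) ⟩
      x * y          ∎

  pos-*-neg : 0# <ᶠ x → y <ᶠ 0# → x * y <ᶠ 0#
  pos-*-neg {x} {y} 0<x y<0 =
    -pos⇒neg (<-respʳ-≈ (≈-sym (-‿distribʳ-* x y)) (*-pos 0<x (neg⇒-pos y<0)))

  negPow-cong : ∀ t → x ≈ y → negPow F t x ≈ negPow F t y
  negPow-cong zero    x≈y = x≈y
  negPow-cong (suc t) x≈y = -‿cong (negPow-cong t x≈y)

  negPow-zero : ∀ t → x ≈ 0# → negPow F t x ≈ 0#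
  negPow-zero zero    x≈0 = x≈0
  negPow-zero (suc t) x≈0 = ≈-trans (-‿cong (negPow-zero t x≈0)) -0#≈0#

  negPow-*ˡ : ∀ t → u * negPow F t y ≈ negPow F t (u * y)
  negPow-*ˡ zero    = ≈-refl
  negPow-*ˡ {u} {y} (suc t) = begin
    u * - negPow F t y      ≈⟨ -‿distribʳ-* u (negPow F t y) ⟨
    - (u * negPow F t y)    ≈⟨ -‿cong (negPow-*ˡ t) ⟩
    - negPow F t (u * y)    ∎

  negPow-suc : ∀ t → negPow F (suc t) y ≈ negPow F t (- y)
  negPow-suc zero    = ≈-refl
  negPow-suc (suc t) = -‿cong (negPow-suc t)

  hasSign-cong : ∀ σ → x ≈ y → HasSign F x σ → HasSign F y σ
  hasSign-cong s+ = <-respʳ-≈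
  hasSign-cong s- = <-respˡ-≈

  hasSign-neg : ∀ σ → HasSign F x σ → HasSign F (- x) (opposite σ)
  hasSign-neg s+ = pos⇒-neg
  hasSign-neg s- = neg⇒-pos

  negPow-pos : ∀ t → 0# <ᶠ y → HasSign F (negPow F t y) (signPow t)
  negPow-pos zero    0<y = 0<y
  negPow-pos (suc t) 0<y = hasSign-neg (signPow t) (negPow-pos t 0<y)

  negPow-neg : ∀ t → y <ᶠ 0# → HasSign F (negPow F (suc t) y) (signPow t)
  negPow-neg t y<0 = hasSign-cong (signPow t) (≈-sym (negPow-suc t)) (negPow-pos t (neg⇒-pos y<0))

  minor : Fin (suc m) → Matrix F (suc m) → Matrix F m
  minor i M r c = M (punchIn i r) (suc c)

  minor-row : ∀ {i k : Fin (suc m)} (M : Matrix F (suc m)) (i≢k : i ≢ k) c →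
              minor i M (punchOut i≢k) c ≡ M k (suc c)
  minor-row M i≢k c = cong (λ r → M r (suc c)) (punchIn-punchOut i≢k)

  sumFin-zero : {f : Fin m → Carrier} → (∀ i → f i ≈ 0#) → sumFin F f ≈ 0#
  sumFin-zero {zero}  f≈0 = ≈-refl
  sumFin-zero {suc m} f≈0 = ≈-trans (+-cong (f≈0 zero) (sumFin-zero (f≈0 ∘ suc))) (+-identityˡ 0#)

  sumFin-single : (f : Fin m → Carrier) (k : Fin m) → (∀ i → i ≢ k → f i ≈ 0#) →
                  sumFin F f ≈ f k
  sumFin-single {suc m} f zero    others =
    ≈-trans (+-cong ≈-refl (sumFin-zero (λ i → others (suc i) λ ()))) (+-identityʳ (f zero))
  sumFin-single {suc m} f (suc k) others =
    ≈-trans (+-cong (others zero λ ())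
                     (sumFin-single (f ∘ suc) k (λ i i≢k → others (suc i) (i≢k ∘ suc-injective))))
            (+-identityˡ (f (suc k)))

  det-zeroRow : (M : Matrix F m) (k : Fin m) → (∀ c → M k c ≈ 0#) → det F M ≈ 0#
  det-zeroRow {suc m} M k row≈0 = sumFin-zero term≈0
    where
    term≈0 : ∀ i → negPow F (toℕ i) (M i zero * det F (minor i M)) ≈ 0#
    term≈0 i with i ≟ᶠ k
    ... | yes refl = negPow-zero (toℕ i) (≈-trans (*-cong (row≈0 zero) ≈-refl) (zeroˡ _))
    ... | no i≢k   = negPow-zero (toℕ i) (≈-trans (*-cong ≈-refl minor≈0) (zeroʳ _))
      where
      minor≈0 : det F (minor i M) ≈ 0#
      minor≈0 = det-zeroRow (minor i M) (punchOut i≢k)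
                  (λ c → subst (_≈ 0#) (sym (minor-row M i≢k c)) (row≈0 (suc c)))

  det-singleTerm : (M : Matrix F (suc m)) (k : Fin (suc m)) →
                   (∀ i → i ≢ k → M i zero ≈ 0# ⊎ det F (minor i M) ≈ 0#) →
                   det F M ≈ negPow F (toℕ k) (M k zero * det F (minor k M))
  det-singleTerm M k others = sumFin-single _ k (λ i i≢k → negPow-zero (toℕ i) (term≈0 (others i i≢k)))
    where
    term≈0 : ∀ {i} → M i zero ≈ 0# ⊎ det F (minor i M) ≈ 0# → M i zero * det F (minor i M) ≈ 0#
    term≈0 (inj₁ entry≈0) = ≈-trans (*-cong entry≈0 ≈-refl) (zeroˡ _)
    term≈0 (inj₂ det≈0)   = ≈-trans (*-cong ≈-refl det≈0) (zeroʳ _)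

  -- If row k vanishes outside column 0, every other cofactor contains that
  -- zero row, so det M = (-1)^k M_k0 det(cofactor k).
  det-rowAtColumnZero : (M : Matrix F (suc m)) (k : Fin (suc m)) → (∀ c → M k (suc c) ≈ 0#) →
                        det F M ≈ negPow F (toℕ k) (M k zero * det F (minor k M))
  det-rowAtColumnZero M k row≈0 = det-singleTerm M k λ i i≢k →
    inj₂ (det-zeroRow (minor i M) (punchOut i≢k) (λ c → subst (_≈ 0#) (sym (minor-row M i≢k c)) (row≈0 c)))

  prodFin : (Fin m → Carrier) → Carrier
  prodFin {zero}  f = 1#
  prodFin {suc m} f = f zero * prodFin (f ∘ suc)

  det-monomialRows : (S : Matrix F (suc m)) (s : Fin (suc m)) →
                     (∀ r c → c ≢ punchIn s r → S (suc r) c ≈ 0#) →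
                     det F S ≈ negPow F (toℕ s) (S zero s * prodFin (λ r → S (suc r) (punchIn s r)))

  det-diagonalCofactor : (S : Matrix F (suc m)) → (∀ r c → c ≢ suc r → S (suc r) c ≈ 0#) →
                         det F (minor zero S) ≈ prodFin (λ r → S (suc r) (suc r))
  det-diagonalCofactor {zero}  S single = ≈-refl
  det-diagonalCofactor {suc m} S single =
    det-monomialRows (minor zero S) zero (λ r c c≢r → single (suc r) (suc c) (c≢r ∘ suc-injective))

  -- s = 0: only row 0 meets column 0.
  det-monomialRows S zero single =
    ≈-trans (det-singleTerm S zero below) (*-cong ≈-refl (det-diagonalCofactor S single))
    where
    below : ∀ i → i ≢ zero → S i zero ≈ 0# ⊎ det F (minor i S) ≈ 0#
    below zero    0≢0 = ⊥-elim (0≢0 refl)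
    below (suc r) _   = inj₁ (single r zero λ ())
  -- s + 1: only row 1 contributes, since the cofactor of row 0 keeps row 1,
  -- which is zero away from column 0; the cofactor of row 1 is again a
  -- staircase, with step s.
  det-monomialRows {suc m} S (suc s) single = begin
    det F S                                            ≈⟨ det-singleTerm S (suc zero) others ⟩
    - (S (suc zero) zero * det F (minor (suc zero) S))  ≈⟨ -‿cong (*-cong ≈-refl (det-monomialRows (minor (suc zero) S) s single′)) ⟩
    - (d * negPow F (toℕ s) (e * rest))                 ≈⟨ -‿cong (negPow-*ˡ (toℕ s)) ⟩
    - negPow F (toℕ s) (d * (e * rest))                 ≈⟨ -‿cong (negPow-cong (toℕ s) (x∙yz≈y∙xz d e rest)) ⟩
    - negPow F (toℕ s) (e * (d * rest))                 ∎
    where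
    d e rest : Carrier
    d    = S (suc zero) zero
    e    = S zero (suc s)
    rest = prodFin (λ r → S (suc (suc r)) (suc (punchIn s r)))
    others : ∀ i → i ≢ suc zero → S i zero ≈ 0# ⊎ det F (minor i S) ≈ 0#
    others zero          _   = inj₂ (det-zeroRow (minor zero S) zero (λ c → single zero (suc c) λ ()))
    others (suc zero)    1≢1 = ⊥-elim (1≢1 refl)
    others (suc (suc r)) _   = inj₁ (single (suc r) zero λ ())
    single′ : ∀ r c → c ≢ punchIn s r → minor (suc zero) S (suc r) c ≈ 0#
    single′ r c c≢ = single (suc r) (suc c) (c≢ ∘ suc-injective)

  prodFin-alternating : ∀ t (f : Fin m → Carrier) → t ≤ m →
                        (∀ i → toℕ i < t → f i <ᶠ 0#) → (∀ i → t ≤ toℕ i → 0# <ᶠ f i) →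
                        0# <ᶠ negPow F t (prodFin f)
  prodFin-alternating {zero}  zero    f _ _ _ = 0<1
  prodFin-alternating {zero}  (suc t) f () _ _
  prodFin-alternating {suc m} zero    f _ _ after =
    *-pos (after zero z≤n) (prodFin-alternating zero (f ∘ suc) z≤n (λ _ ()) (λ i _ → after (suc i) z≤n))
  prodFin-alternating {suc m} (suc t) f (s≤s t≤m) before after =
    <-respʳ-≈ sign-flip (*-pos (neg⇒-pos (before zero (s≤s z≤n))) tail-sign)
    where
    tail-sign : 0# <ᶠ negPow F t (prodFin (f ∘ suc))
    tail-sign = prodFin-alternating t (f ∘ suc) t≤m
                  (λ i i<t → before (suc i) (s≤s i<t)) (λ i t≤i → after (suc i) (s≤s t≤i))
    sign-flip : - f zero * negPow F t (prodFin (f ∘ suc)) ≈ negPow F (suc t) (prodFin f)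
    sign-flip = ≈-trans (≈-sym (-‿distribˡ-* (f zero) _)) (-‿cong (negPow-*ˡ t))

  decreasing : (b : ℕ → Carrier) {L : ℕ} → (∀ t → 1 ≤ t → t < L → b (suc t) <ᶠ b t) →
               ∀ {u v} → 1 ≤ u → u < v → v ≤ L → b v <ᶠ b u
  decreasing b step {u} {suc v} 1≤u (s≤s u≤v) v<L with m≤n⇒m<n∨m≡n u≤v
  ... | inj₂ refl = step u 1≤u v<L
  ... | inj₁ u<v  = <-trans (step v (≤-trans 1≤u u≤v) v<L) (decreasing b step 1≤u u<v (<⇒≤ v<L))

  module ShiftedArrow (m : ℕ) (a b : ℕ → Carrier) (x : Carrier) where

    M : Matrix F (suc (suc (suc m)))
    M = shift F x (arrowB F (suc (suc (suc m))) a b)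

    M-top : ∀ c → M zero (suc c) ≈ 1#
    M-top c = ≈-trans (+-cong (zeroʳ x) ≈-refl) (+-identityˡ 1#)

    M-left : ∀ r → M (suc r) zero ≈ a (suc (suc (toℕ r)))
    M-left r = ≈-trans (+-cong (zeroʳ x) ≈-refl) (+-identityˡ _)

    M-off : ∀ r c → r ≢ c → M (suc r) (suc c) ≈ 0#
    M-off r c r≢c rewrite ≡ᵇ-false (toℕ r) (toℕ c) (r≢c ∘ toℕ-injective) =
      ≈-trans (+-identityʳ _) (zeroʳ x)

    M-diag₁ : M (suc zero) (suc zero) ≈ x
    M-diag₁ = ≈-trans (+-identityʳ _) (*-identityʳ x)

    M-diag : ∀ q → M (suc (suc q)) (suc (suc q)) ≈ x - b (suc (toℕ q))
    M-diag q rewrite ≡ᵇ-refl (toℕ q) = +-cong (*-identityʳ x) ≈-refl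

    -- Take x = b_j with j = 1 + toℕ p, so that row p + 2 of M (0-based) has
    -- diagonal entry b_j - b_j = 0.
    module AtZeroRow (p : Fin (suc m)) (x≈bⱼ : x ≈ b (suc (toℕ p))) where

      zeroRow : ∀ c → M (suc (suc p)) (suc c) ≈ 0#
      zeroRow c with c ≟ᶠ suc p
      ... | yes refl = ≈-trans (M-diag p) (≈-trans (+-cong x≈bⱼ ≈-refl) (-‿inverseʳ _))
      ... | no c≢p   = M-off (suc p) c (c≢p ∘ sym)

      C : Matrix F (suc (suc m))
      C = minor (suc (suc p)) M

      det-M : det F M ≈ negPow F (suc (suc (toℕ p))) (a (suc (suc (suc (toℕ p)))) * det F C)
      det-M = ≈-trans (det-rowAtColumnZero M (suc (suc p)) zeroRow)
                      (negPow-cong (suc (suc (toℕ p))) (*-cong (M-left (suc p)) ≈-refl))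

      -- Row r + 1 of C is row punchIn (p+1) r + 1 of M, nonzero only on its
      -- diagonal: C is a staircase with step p + 1.  Its entries are the
      -- diagonal entries of M other than the vanishing one.
      factor : Fin (suc m) → Carrier
      factor r = C (suc r) (punchIn (suc p) r)

      det-C : det F C ≈ - ((C zero (suc p) * factor zero) * negPow F (toℕ p) (prodFin (factor ∘ suc)))
      det-C = begin
        det F C                                    ≈⟨ det-monomialRows C (suc p) staircase ⟩
        - negPow F (toℕ p) (e * (f₀ * rest))       ≈⟨ -‿cong (negPow-cong (toℕ p) (≈-sym (*-assoc e f₀ rest))) ⟩
        - negPow F (toℕ p) ((e * f₀) * rest)       ≈⟨ -‿cong (negPow-*ˡ (toℕ p)) ⟨
        - ((e * f₀) * negPow F (toℕ p) rest)       ∎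
        where
        e f₀ rest : Carrier
        e    = C zero (suc p)
        f₀   = factor zero
        rest = prodFin (factor ∘ suc)
        staircase : ∀ r c → c ≢ punchIn (suc p) r → C (suc r) c ≈ 0#
        staircase r c c≢ = M-off (punchIn (suc p) r) c (c≢ ∘ sym)

      module Signs (0<x : 0# <ᶠ x) (step : ∀ t → 1 ≤ t → t < suc m → b (suc t) <ᶠ b t) where

        factor-before : ∀ r → toℕ r < toℕ p → factor (suc r) <ᶠ 0#
        factor-before r r<p =
          <-respˡ-≈ (≈-sym (M-diag (punchIn p r)))
            (subst (λ t → x - b (suc t) <ᶠ 0#) (sym (toℕ-punchIn-below p r r<p))
              (sub-neg (<-respˡ-≈ (≈-sym x≈bⱼ) (decreasing b step (s≤s z≤n) (s≤s r<p) (toℕ<n p)))))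

        factor-after : ∀ r → toℕ p ≤ toℕ r → 0# <ᶠ factor (suc r)
        factor-after r p≤r =
          <-respʳ-≈ (≈-sym (M-diag (punchIn p r)))
            (subst (λ t → 0# <ᶠ x - b (suc t)) (sym (toℕ-punchIn-above p r p≤r))
              (sub-pos (<-respʳ-≈ (≈-sym x≈bⱼ) (decreasing b step (s≤s z≤n) (s≤s (s≤s p≤r)) (s≤s (toℕ<n r))))))

        det-C-neg : det F C <ᶠ 0#
        det-C-neg = <-respˡ-≈ (≈-sym det-C) (pos⇒-neg (*-pos (*-pos top first) tail))
          where
          top : 0# <ᶠ C zero (suc p)
          top = <-respʳ-≈ (≈-sym (M-top (suc p))) 0<1
          first : 0# <ᶠ factor zero
          first = <-respʳ-≈ (≈-sym M-diag₁) 0<x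
          tail : 0# <ᶠ negPow F (toℕ p) (prodFin (factor ∘ suc))
          tail = prodFin-alternating (toℕ p) (factor ∘ suc) (≤-pred (toℕ<n p)) factor-before factor-after

  module _ (m : ℕ) (a b : ℕ → Carrier) (p : Fin (suc m)) (0<bⱼ : 0# <ᶠ b (suc (toℕ p)))
           (step : ∀ t → 1 ≤ t → t < suc m → b (suc t) <ᶠ b t) where
    open ShiftedArrow m a b (b (suc (toℕ p)))
    open AtZeroRow p ≈-refl
    open Signs 0<bⱼ step

    shiftedArrow-sign-neg : a (suc (suc (suc (toℕ p)))) <ᶠ 0# →
                            HasSign F (det F M) (signPow (suc (suc (toℕ p))))
    shiftedArrow-sign-neg a<0 =
      hasSign-cong (signPow (suc (suc (toℕ p)))) (≈-sym det-M)
        (negPow-pos (suc (suc (toℕ p))) (neg-*-neg a<0 det-C-neg))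

    shiftedArrow-sign-pos : 0# <ᶠ a (suc (suc (suc (toℕ p)))) →
                            HasSign F (det F M) (signPow (suc (toℕ p)))
    shiftedArrow-sign-pos 0<a =
      hasSign-cong (signPow (suc (toℕ p))) (≈-sym det-M)
        (negPow-neg (suc (toℕ p)) (pos-*-neg 0<a det-C-neg))

  module Pattern (m : ℕ) (a b : ℕ → Carrier) where
    B : Matrix F (suc (suc (suc m)))
    B = arrowB F (suc (suc (suc m))) a b

    𝒜₁-left : InQ F (𝒜₁ (suc (suc (suc m)))) B → ∀ p → a (suc (suc (suc (toℕ p)))) <ᶠ 0#
    𝒜₁-left Q p = lower (Q (suc (suc p)) zero)

    𝒜₂-left : InQ F (𝒜₂ (suc (suc (suc m)))) B → ∀ p → 0# <ᶠ a (suc (suc (suc (toℕ p))))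
    𝒜₂-left Q p = lower (Q (suc (suc p)) zero)

    𝒜₃-left : InQ F (𝒜₃ (suc (suc (suc m)))) B →
              ∀ p → toℕ p ≢ m → 0# <ᶠ a (suc (suc (suc (toℕ p))))
    𝒜₃-left Q p p≢m with toℕ p ≡ᵇ m | ≡ᵇ-false (toℕ p) m p≢m | Q (suc (suc p)) zero
    ... | .false | refl | entry = lower entry

    𝒜₁-diag : InQ F (𝒜₁ (suc (suc (suc m)))) B → ∀ q → 0# <ᶠ b (suc (toℕ q))
    𝒜₁-diag Q q with toℕ q ≡ᵇ toℕ q | ≡ᵇ-refl (toℕ q) | Q (suc (suc q)) (suc (suc q))
    ... | .true | refl | entry = <-respʳ-≈ (-‿involutive _) (neg⇒-pos (lower entry))

    𝒜₂-diag : InQ F (𝒜₂ (suc (suc (suc m)))) B → ∀ q → 0# <ᶠ b (suc (toℕ q))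
    𝒜₂-diag Q q with toℕ q ≡ᵇ toℕ q | ≡ᵇ-refl (toℕ q) | Q (suc (suc q)) (suc (suc q))
    ... | .true | refl | entry = <-respʳ-≈ (-‿involutive _) (neg⇒-pos (lower entry))

-- Write n = m + 3 and j = 1 + j₀ with j₀ = toℕ p.  For A_1 and A_2 the
-- pattern gives b_j > 0 and a_{j+2} < 0, resp. > 0; for A_3 we have j ≤ n - 3,
-- so b_j > 0 is a hypothesis and row j + 2 ≠ n, whence a_{j+2} > 0.
lemma3p3 : ∀ {c ℓ₁ ℓ₂} (F : OrderedField c ℓ₁ ℓ₂) (n : ℕ) → 5 ≤ n → (i : Fin 3)
    → (a b : ℕ → OrderedField.Carrier F)
    → (∀ j → 1 ≤ j → j ≤ n ∸ 3 → OrderedField._<_ F (OrderedField.0# F) (b j))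
    → (∀ j → 1 ≤ j → j < n ∸ 2 → OrderedField._<_ F (b (suc j)) (b j))
    → InQ F (𝒜 i n) (arrowB F n a b)
    → ∀ j → 1 ≤ j → j ≤ upper i n
    → HasSign F (det F (shift F (b j) (arrowB F n a b))) (expectedSign i j)
lemma3p3 F _ (s≤s (s≤s (s≤s (s≤s (s≤s {n = k} _))))) zero a b _ step Q (suc j₀) _ j≤n-2 =
  viaFin (λ t → HasSign F (det F (shift F (b (suc t)) B)) (signPow (suc (suc t))))
    (λ p → shiftedArrow-sign-neg m a b p (𝒜₁-diag Q p) step (𝒜₁-left Q p)) j₀ j≤n-2
  where
  m : ℕ
  m = suc (suc k)
  open Development F
  open Pattern m a b
lemma3p3 F _ (s≤s (s≤s (s≤s (s≤s (s≤s {n = k} _))))) (suc zero) a b _ step Q (suc j₀) _ j≤n-2 =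
  viaFin (λ t → HasSign F (det F (shift F (b (suc t)) B)) (signPow (suc t)))
    (λ p → shiftedArrow-sign-pos m a b p (𝒜₂-diag Q p) step (𝒜₂-left Q p)) j₀ j≤n-2
  where
  m : ℕ
  m = suc (suc k)
  open Development F
  open Pattern m a b
lemma3p3 F _ (s≤s (s≤s (s≤s (s≤s (s≤s {n = k} _))))) (suc (suc zero)) a b b-pos step Q (suc j₀) _ j≤n-3 =
  viaFin (λ t → suc t ≤ m → HasSign F (det F (shift F (b (suc t)) B)) (signPow (suc t)))
    (λ p j≤m → shiftedArrow-sign-pos m a b p (b-pos _ (s≤s z≤n) j≤m) step (𝒜₃-left Q p (<⇒≢ j≤m)))
    j₀ (m≤n⇒m≤1+n j≤n-3) j≤n-3
  where
  m : ℕ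
  m = suc (suc k)
  open Development F
  open Pattern m a b
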